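{- Let $G$ be a cograph with vertex set $V$. For every nonempty set $U\subseteq V$ there exists a subset $W\subseteq V$ such that (1) $\tfrac14|U|\le |U\cap W|\le \max\{\tfrac12|U|,1\}$, and (2) for every $v\in V\setminus W$, $W$ conforms to $v$.
   Context: A cograph is a graph obtainable from a single vertex by repeatedly taking complements and disjoint unions (equivalently, a graph with no induced path on four vertices). For a vertex $v$ of $G$ with neighborhood $N(v)$ and a set $W\subseteq V(G)\setminus\{v\}$, we say $W$ conforms to $v$ if either $W\subseteq N(v)$ or $W\cap N(v)=\emptyset$. -}

module Defs where

open import Data.Nat using (ℕ; _+_; _*_; _≤_)
open import Data.Bool using (Bool; true; false; not; if_then_else_)
open import Data.Fin using (Fin; splitAt; _≟_)
open import Data.Fin.Subset using (Subset; _∈_; _∉_; _∩_; ∣_∣; Nonempty)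
open import Data.Fin.Permutation using (Permutation′; _⟨$⟩ʳ_)
open import Data.Sum using (_⊎_; inj₁; inj₂)
open import Data.Product using (_×_)
open import Relation.Nullary using (does)
open import Relation.Binary.PropositionalEquality using (_≡_)

Graph : ℕ → Set
Graph n = Fin n → Fin n → Bool

complement : ∀ {n} → Graph n → Graph n
complement G u v = if does (u ≟ v) then false else not (G u v)

unionAdj : ∀ {m k} → Graph m → Graph k → Fin m ⊎ Fin k → Fin m ⊎ Fin k → Bool
unionAdj G H (inj₁ a) (inj₁ b) = G a b
unionAdj G H (inj₂ a) (inj₂ b) = H a b
unionAdj G H (inj₁ _) (inj₂ _) = false
unionAdj G H (inj₂ _) (inj₁ _) = false

disjointUnion : ∀ {m k} → Graph m → Graph k → Graph (m + k)
disjointUnion {m} G H u v = unionAdj G H (splitAt m u) (splitAt m v)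

-- Cographs: obtainable from the single-vertex graph by complements and
-- disjoint unions (graphs considered up to isomorphism, i.e. relabelling).
data Cograph : (n : ℕ) → Graph n → Set where
  single : Cograph 1 (λ _ _ → false)
  compl  : ∀ {n} {G : Graph n} → Cograph n G → Cograph n (complement G)
  union  : ∀ {m k} {G : Graph m} {H : Graph k} →
           Cograph m G → Cograph k H → Cograph (m + k) (disjointUnion G H)
  relabel : ∀ {n} {G H : Graph n} (σ : Permutation′ n) → Cograph n G →
           (∀ u v → H u v ≡ G (σ ⟨$⟩ʳ u) (σ ⟨$⟩ʳ v)) → Cograph n H

Conforms : ∀ {n} → Graph n → Subset n → Fin n → Set
Conforms G W v = (∀ w → w ∈ W → G v w ≡ true) ⊎ (∀ w → w ∈ W → G v w ≡ false)

Balanced : ∀ {n} → Subset n → Subset n → Set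
Balanced U W = (∣ U ∣ ≤ 4 * ∣ U ∩ W ∣) × ((2 * ∣ U ∩ W ∣ ≤ ∣ U ∣) ⊎ (∣ U ∩ W ∣ ≤ 1))

-- Strengthen the claim: for every target N ≤ 4|U| there is a module W (a set to
-- which every outside vertex conforms) with N ≤ 4|U ∩ W| and
-- 2|U ∩ W| ≤ N or |U ∩ W| ≤ 1.  Induct on the construction of the cograph.
-- Complements and relabellings preserve modules.  In a disjoint union G + H, if
-- 2|U| ≤ N the whole vertex set works; otherwise U ∩ V(G) or U ∩ V(H) has at
-- least N/4 elements, and a module of that side is a module of G + H.
module Submission where

open import Defs
open import Data.Nat using (ℕ; suc; _+_; _*_; _≤_; _<_; _≤?_)
open import Data.Nat.Properties
  using (<⇒≤; ≰⇒>; m≤n*m; +-identityʳ; +-cancelˡ-<; +-monoˡ-<; *-distribˡ-+; *-distribʳ-+;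
         +-0-commutativeMonoid; module ≤-Reasoning)
open import Data.Bool using (Bool; false; not; _∧_; if_then_else_)
open import Data.Fin using (Fin; splitAt; join; _↑ˡ_; _↑ʳ_; _≟_)
open import Data.Fin.Properties using (splitAt-join; join-splitAt)
open import Data.Fin.Subset using (Subset; inside; outside; _∈_; _∉_; _∩_; ⊤; ⊥; ∣_∣; Nonempty)
open import Data.Fin.Subset.Properties using (∈⊤; ∉⊥; ∣⊥∣≡0; ∣p∣≤n; ∩-identityʳ; ∩-zeroʳ)
open import Data.Fin.Permutation using (Permutation; Permutation′; _⟨$⟩ʳ_; _⟨$⟩ˡ_; inverseˡ; flip)
open import Data.Vec as Vec using ([]; _∷_; _++_; lookup; tabulate)
open import Data.Vec.Properties
  using ([]=⇒lookup; lookup⇒[]=; lookup∘tabulate; tabulate∘lookup; tabulate-cong;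
         lookup-zipWith; lookup-++ˡ; lookup-++ʳ; zipWith-++)
open import Data.Sum using (_⊎_; inj₁; inj₂; map; swap)
open import Data.Product using (Σ; _×_; _,_)
open import Data.Empty using (⊥-elim)
open import Function using (_∘_)
open import Relation.Nullary using (yes; no; ¬_)
open import Relation.Binary.PropositionalEquality
open import Algebra.Properties.CommutativeMonoid.Sum +-0-commutativeMonoid using (sum; sum-permute; sum-cong-≗)

private
  variable
    m n k : ℕ

∈-resp-lookup : {p : Subset m} {q : Subset n} {x : Fin m} {y : Fin n} →
                lookup p x ≡ lookup q y → x ∈ p → y ∈ q
∈-resp-lookup {q = q} {y = y} eq x∈p = lookup⇒[]= y q (trans (sym eq) ([]=⇒lookup x∈p))

indicator : Bool → ℕ
indicator b = if b then 1 else 0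

∣p∣≡∑ : (p : Subset n) → ∣ p ∣ ≡ sum (indicator ∘ lookup p)
∣p∣≡∑ []            = refl
∣p∣≡∑ (inside  ∷ p) = cong suc (∣p∣≡∑ p)
∣p∣≡∑ (outside ∷ p) = ∣p∣≡∑ p

∣p++q∣≡∣p∣+∣q∣ : (p : Subset m) (q : Subset n) → ∣ p ++ q ∣ ≡ ∣ p ∣ + ∣ q ∣
∣p++q∣≡∣p∣+∣q∣ []            q = refl
∣p++q∣≡∣p∣+∣q∣ (inside  ∷ p) q = cong suc (∣p++q∣≡∣p∣+∣q∣ p q)
∣p++q∣≡∣p∣+∣q∣ (outside ∷ p) q = ∣p++q∣≡∣p∣+∣q∣ p q

∣[p++q]∩[r++s]∣ : (p r : Subset m) (q s : Subset n) →
                  ∣ (p ++ q) ∩ (r ++ s) ∣ ≡ ∣ p ∩ r ∣ + ∣ q ∩ s ∣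
∣[p++q]∩[r++s]∣ p r q s = trans (cong ∣_∣ (zipWith-++ _∧_ p q r s)) (∣p++q∣≡∣p∣+∣q∣ (p ∩ r) (q ∩ s))

∣p∩⊥∣≡0 : (p : Subset n) → ∣ p ∩ ⊥ ∣ ≡ 0
∣p∩⊥∣≡0 {n} p = trans (cong ∣_∣ (∩-zeroʳ p)) (∣⊥∣≡0 n)

preimage : (Fin m → Fin n) → Subset n → Subset m
preimage f p = tabulate (lookup p ∘ f)

module _ {f : Fin m → Fin n} {p : Subset n} {x : Fin m} where

  ∈-preimage⁺ : f x ∈ p → x ∈ preimage f p
  ∈-preimage⁺ = ∈-resp-lookup (sym (lookup∘tabulate (lookup p ∘ f) x))

  ∈-preimage⁻ : x ∈ preimage f p → f x ∈ p
  ∈-preimage⁻ = ∈-resp-lookup (lookup∘tabulate (lookup p ∘ f) x)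

preimage-∩ : (f : Fin m → Fin n) (p q : Subset n) →
             preimage f (p ∩ q) ≡ preimage f p ∩ preimage f q
preimage-∩ f p q = begin
  tabulate (λ i → lookup (p ∩ q) (f i))             ≡⟨ tabulate-cong (λ i → lookup-zipWith _∧_ (f i) p q) ⟩
  tabulate (λ i → lookup p (f i) ∧ lookup q (f i))  ≡⟨ tabulate-cong pointwise ⟨
  tabulate (lookup (preimage f p ∩ preimage f q))   ≡⟨ tabulate∘lookup _ ⟩
  preimage f p ∩ preimage f q                       ∎
  where
  open ≡-Reasoning
  pointwise : ∀ i → lookup (preimage f p ∩ preimage f q) i ≡ lookup p (f i) ∧ lookup q (f i)
  pointwise i = trans (lookup-zipWith _∧_ i (preimage f p) (preimage f q))
                      (cong₂ _∧_ (lookup∘tabulate _ i) (lookup∘tabulate _ i))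

preimage-inverse : (f : Fin m → Fin n) (g : Fin n → Fin m) → (∀ i → g (f i) ≡ i) →
                   (p : Subset m) → preimage f (preimage g p) ≡ p
preimage-inverse f g g∘f≗id p =
  trans (tabulate-cong (λ i → trans (lookup∘tabulate (lookup p ∘ g) (f i)) (cong (lookup p) (g∘f≗id i))))
        (tabulate∘lookup p)

∣preimage∣ : (π : Permutation m n) (p : Subset n) → ∣ preimage (π ⟨$⟩ʳ_) p ∣ ≡ ∣ p ∣
∣preimage∣ π p = begin
  ∣ preimage (π ⟨$⟩ʳ_) p ∣
    ≡⟨ ∣p∣≡∑ (preimage (π ⟨$⟩ʳ_) p) ⟩
  sum (indicator ∘ lookup (preimage (π ⟨$⟩ʳ_) p))
    ≡⟨ sum-cong-≗ (cong indicator ∘ lookup∘tabulate (lookup p ∘ (π ⟨$⟩ʳ_))) ⟩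
  sum (indicator ∘ lookup p ∘ (π ⟨$⟩ʳ_))
    ≡⟨ sum-permute (indicator ∘ lookup p) π ⟨
  sum (indicator ∘ lookup p)
    ≡⟨ ∣p∣≡∑ p ⟨
  ∣ p ∣
    ∎
  where open ≡-Reasoning

module _ (p : Subset m) (q : Subset n) where

  ∈-++⁺ˡ : ∀ {a} → a ∈ p → a ↑ˡ n ∈ p ++ q
  ∈-++⁺ˡ {a} = ∈-resp-lookup (sym (lookup-++ˡ p q a))

  ∈-++⁻ˡ : ∀ {a} → a ↑ˡ n ∈ p ++ q → a ∈ p
  ∈-++⁻ˡ {a} = ∈-resp-lookup (lookup-++ˡ p q a)

  ∈-++⁺ʳ : ∀ {b} → b ∈ q → m ↑ʳ b ∈ p ++ q
  ∈-++⁺ʳ {b} = ∈-resp-lookup (sym (lookup-++ʳ p q b))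

  ∈-++⁻ʳ : ∀ {b} → m ↑ʳ b ∈ p ++ q → b ∈ q
  ∈-++⁻ʳ {b} = ∈-resp-lookup (lookup-++ʳ p q b)

data Split (m k : ℕ) : Fin (m + k) → Set where
  left  : (a : Fin m) → Split m k (a ↑ˡ k)
  right : (b : Fin k) → Split m k (m ↑ʳ b)

split : ∀ m {k} (i : Fin (m + k)) → Split m k i
split m {k} i = subst (Split m k) (join-splitAt m k i) (viewJoin (splitAt m i))
  where
  viewJoin : (x : Fin m ⊎ Fin k) → Split m k (join m k x)
  viewJoin (inj₁ a) = left a
  viewJoin (inj₂ b) = right b

disjointUnion-join : (G : Graph m) (H : Graph k) (x y : Fin m ⊎ Fin k) →
                     disjointUnion G H (join m k x) (join m k y) ≡ unionAdj G H x y
disjointUnion-join {m} {k} G H x y = cong₂ (unionAdj G H) (splitAt-join m k x) (splitAt-join m k y)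

AllAdj : Graph n → Subset n → Fin n → Bool → Set
AllAdj G W v b = ∀ w → w ∈ W → G v w ≡ b

IsModule : Graph n → Subset n → Set
IsModule G W = ∀ v → v ∉ W → Conforms G W v

⊤-isModule : (G : Graph n) → IsModule G ⊤
⊤-isModule G v v∉⊤ = ⊥-elim (v∉⊤ ∈⊤)

complement-≢ : (G : Graph n) {v w : Fin n} → ¬ v ≡ w → complement G v w ≡ not (G v w)
complement-≢ G {v} {w} v≢w with v ≟ w
... | yes v≡w = ⊥-elim (v≢w v≡w)
... | no  _   = refl

complement-isModule : (G : Graph n) {W : Subset n} → IsModule G W → IsModule (complement G) W
complement-isModule G {W} isMod v v∉W = swap (map flipAll flipAll (isMod v v∉W))
  where
  flipAll : ∀ {b} → AllAdj G W v b → AllAdj (complement G) W v (not b)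
  flipAll adj w w∈W = trans (complement-≢ G (λ { refl → v∉W w∈W })) (cong not (adj w w∈W))

preimage-isModule : {G : Graph n} {H : Graph m} {W : Subset n} (f : Fin m → Fin n) →
                    (∀ u v → H u v ≡ G (f u) (f v)) → IsModule G W → IsModule H (preimage f W)
preimage-isModule {G = G} {H} {W} f H≡G∘f isMod v v∉ =
  map pullBack pullBack (isMod (f v) (v∉ ∘ ∈-preimage⁺))
  where
  pullBack : ∀ {b} → AllAdj G W (f v) b → AllAdj H (preimage f W) v b
  pullBack adj w w∈ = trans (H≡G∘f v w) (adj (f w) (∈-preimage⁻ w∈))

module _ {G : Graph m} (H : Graph k) {W : Subset m} where

  ++⊥-isModule : IsModule G W → IsModule (disjointUnion G H) (W ++ ⊥)
  ++⊥-isModule isMod v v∉ with split m v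
  ... | left a  = map fromG fromG (isMod a (v∉ ∘ ∈-++⁺ˡ W ⊥))
    where
    fromG : ∀ {b} → AllAdj G W a b → AllAdj (disjointUnion G H) (W ++ ⊥) (a ↑ˡ k) b
    fromG adj w w∈ with split m w
    ... | left c  = trans (disjointUnion-join G H (inj₁ a) (inj₁ c)) (adj c (∈-++⁻ˡ W ⊥ w∈))
    ... | right e = ⊥-elim (∉⊥ (∈-++⁻ʳ W ⊥ w∈))
  ... | right d = inj₂ fromH
    where
    fromH : AllAdj (disjointUnion G H) (W ++ ⊥) (m ↑ʳ d) false
    fromH w w∈ with split m w
    ... | left c  = disjointUnion-join G H (inj₂ d) (inj₁ c)
    ... | right e = ⊥-elim (∉⊥ (∈-++⁻ʳ W ⊥ w∈))

module _ (G : Graph m) {H : Graph k} {W : Subset k} where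

  ⊥++-isModule : IsModule H W → IsModule (disjointUnion G H) (⊥ ++ W)
  ⊥++-isModule isMod v v∉ with split m v
  ... | left a  = inj₂ fromG
    where
    fromG : AllAdj (disjointUnion G H) (⊥ ++ W) (a ↑ˡ k) false
    fromG w w∈ with split m w
    ... | left c  = ⊥-elim (∉⊥ (∈-++⁻ˡ ⊥ W w∈))
    ... | right e = disjointUnion-join G H (inj₁ a) (inj₂ e)
  ... | right d = map fromH fromH (isMod d (v∉ ∘ ∈-++⁺ʳ ⊥ W))
    where
    fromH : ∀ {b} → AllAdj H W d b → AllAdj (disjointUnion G H) (⊥ ++ W) (m ↑ʳ d) b
    fromH adj w w∈ with split m w
    ... | left c  = ⊥-elim (∉⊥ (∈-++⁻ˡ ⊥ W w∈))
    ... | right e = trans (disjointUnion-join G H (inj₂ d) (inj₂ e)) (adj e (∈-++⁻ʳ ⊥ W w∈))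

BalancedCount : ℕ → ℕ → Set
BalancedCount N c = N ≤ 4 * c × (2 * c ≤ N ⊎ c ≤ 1)

n<2[a+b]⇒4a<n⇒n≤4b : ∀ {N} a b → N < 2 * (a + b) → 4 * a < N → N ≤ 4 * b
n<2[a+b]⇒4a<n⇒n≤4b {N} a b N<2[a+b] 4a<N = <⇒≤ (begin-strict
  N              <⟨ N<2[a+b] ⟩
  2 * (a + b)    ≡⟨ *-distribˡ-+ 2 a b ⟩
  2 * a + 2 * b  <⟨ +-monoˡ-< (2 * b) 2a<2b ⟩
  2 * b + 2 * b  ≡⟨ *-distribʳ-+ b 2 2 ⟨
  4 * b          ∎)
  where
  open ≤-Reasoning
  2a<2b : 2 * a < 2 * b
  2a<2b = +-cancelˡ-< (2 * a) (2 * a) (2 * b) (begin-strict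
    2 * a + 2 * a  ≡⟨ *-distribʳ-+ a 2 2 ⟨
    4 * a          <⟨ 4a<N ⟩
    N              <⟨ N<2[a+b] ⟩
    2 * (a + b)    ≡⟨ *-distribˡ-+ 2 a b ⟩
    2 * a + 2 * b  ∎)

BalancedModule : Graph n → Subset n → ℕ → Set
BalancedModule {n} G U N = Σ (Subset n) λ W → BalancedCount N ∣ U ∩ W ∣ × IsModule G W

⊤-balancedModule : (G : Graph n) (U : Subset n) {N : ℕ} →
                   N ≤ 4 * ∣ U ∣ → 2 * ∣ U ∣ ≤ N ⊎ ∣ U ∣ ≤ 1 → BalancedModule G U N
⊤-balancedModule G U {N} N≤4∣U∣ upper =
  ⊤ , subst (BalancedCount N) (sym (cong ∣_∣ (∩-identityʳ U))) (N≤4∣U∣ , upper) , ⊤-isModule G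

complement-balancedModule : (G : Graph n) (U : Subset n) {N : ℕ} →
                            BalancedModule G U N → BalancedModule (complement G) U N
complement-balancedModule G U (W , balanced , isMod) = W , balanced , complement-isModule G isMod

preimage-balancedModule : {G H : Graph n} (σ : Permutation′ n) (U : Subset n) {N : ℕ} →
                          (∀ u v → H u v ≡ G (σ ⟨$⟩ʳ u) (σ ⟨$⟩ʳ v)) →
                          BalancedModule G (preimage (σ ⟨$⟩ˡ_) U) N → BalancedModule H U N
preimage-balancedModule {n = n} σ U {N} H≡G∘σ (W , balanced , isMod) =
  σ*W , subst (BalancedCount N) (sym count) balanced , preimage-isModule (σ ⟨$⟩ʳ_) H≡G∘σ isMod
  where
  open ≡-Reasoning
  σ*W : Subset n
  σ*W = preimage (σ ⟨$⟩ʳ_) W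
  U′ : Subset n
  U′ = preimage (σ ⟨$⟩ˡ_) U
  σ*U′≡U : preimage (σ ⟨$⟩ʳ_) U′ ≡ U
  σ*U′≡U = preimage-inverse (σ ⟨$⟩ʳ_) (σ ⟨$⟩ˡ_) (λ _ → inverseˡ σ) U
  count : ∣ U ∩ σ*W ∣ ≡ ∣ U′ ∩ W ∣
  count = begin
    ∣ U ∩ σ*W ∣                       ≡⟨ cong (λ V → ∣ V ∩ σ*W ∣) σ*U′≡U ⟨
    ∣ preimage (σ ⟨$⟩ʳ_) U′ ∩ σ*W ∣   ≡⟨ cong ∣_∣ (preimage-∩ (σ ⟨$⟩ʳ_) U′ W) ⟨
    ∣ preimage (σ ⟨$⟩ʳ_) (U′ ∩ W) ∣   ≡⟨ ∣preimage∣ σ (U′ ∩ W) ⟩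
    ∣ U′ ∩ W ∣                        ∎

module _ (G : Graph m) (H : Graph k) (U₁ : Subset m) (U₂ : Subset k) {N : ℕ} where

  ++⊥-balancedModule : BalancedModule G U₁ N → BalancedModule (disjointUnion G H) (U₁ ++ U₂) N
  ++⊥-balancedModule (W , balanced , isMod) =
    W ++ ⊥ , subst (BalancedCount N) (sym count) balanced , ++⊥-isModule H isMod
    where
    count : ∣ (U₁ ++ U₂) ∩ (W ++ ⊥) ∣ ≡ ∣ U₁ ∩ W ∣
    count = trans (∣[p++q]∩[r++s]∣ U₁ W U₂ ⊥) (trans (cong (∣ U₁ ∩ W ∣ +_) (∣p∩⊥∣≡0 U₂)) (+-identityʳ _))

  ⊥++-balancedModule : BalancedModule H U₂ N → BalancedModule (disjointUnion G H) (U₁ ++ U₂) N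
  ⊥++-balancedModule (W , balanced , isMod) =
    ⊥ ++ W , subst (BalancedCount N) (sym count) balanced , ⊥++-isModule G isMod
    where
    count : ∣ (U₁ ++ U₂) ∩ (⊥ ++ W) ∣ ≡ ∣ U₂ ∩ W ∣
    count = trans (∣[p++q]∩[r++s]∣ U₁ ⊥ U₂ W) (cong (_+ ∣ U₂ ∩ W ∣) (∣p∩⊥∣≡0 U₁))

cograph-balancedModule : {G : Graph n} → Cograph n G → (U : Subset n) {N : ℕ} →
                         N ≤ 4 * ∣ U ∣ → BalancedModule G U N
cograph-balancedModule single U N≤4∣U∣ = ⊤-balancedModule _ U N≤4∣U∣ (inj₂ (∣p∣≤n U))
cograph-balancedModule (compl {G = G} cG) U N≤4∣U∣ =
  complement-balancedModule G U (cograph-balancedModule cG U N≤4∣U∣)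
cograph-balancedModule (relabel σ cG H≡G∘σ) U {N} N≤4∣U∣ =
  preimage-balancedModule σ U H≡G∘σ (cograph-balancedModule cG (preimage (σ ⟨$⟩ˡ_) U) N≤4∣σU∣)
  where
  N≤4∣σU∣ : N ≤ 4 * ∣ preimage (σ ⟨$⟩ˡ_) U ∣
  N≤4∣σU∣ = subst (λ c → N ≤ 4 * c) (sym (∣preimage∣ (flip σ) U)) N≤4∣U∣
cograph-balancedModule (union {m} {G = G} {H} cG cH) U {N} N≤4∣U∣ with Vec.splitAt m U
... | U₁ , U₂ , refl with 2 * ∣ U₁ ++ U₂ ∣ ≤? N | N ≤? 4 * ∣ U₁ ∣
...   | yes 2∣U∣≤N | _ = ⊤-balancedModule _ (U₁ ++ U₂) N≤4∣U∣ (inj₁ 2∣U∣≤N)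
...   | no _ | yes N≤4∣U₁∣ = ++⊥-balancedModule G H U₁ U₂ (cograph-balancedModule cG U₁ N≤4∣U₁∣)
...   | no 2∣U∣≰N | no N≰4∣U₁∣ = ⊥++-balancedModule G H U₁ U₂ (cograph-balancedModule cH U₂ N≤4∣U₂∣)
  where
  N≤4∣U₂∣ : N ≤ 4 * ∣ U₂ ∣
  N≤4∣U₂∣ = n<2[a+b]⇒4a<n⇒n≤4b ∣ U₁ ∣ ∣ U₂ ∣
    (subst (λ c → N < 2 * c) (∣p++q∣≡∣p∣+∣q∣ U₁ U₂) (≰⇒> 2∣U∣≰N)) (≰⇒> N≰4∣U₁∣)

lemma3p2 : (n : ℕ) (G : Graph n) → Cograph n G →
    (U : Subset n) → Nonempty U →
    Σ (Subset n) (λ W → Balanced U W × (∀ v → v ∉ W → Conforms G W v))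
lemma3p2 n G cG U _ = cograph-balancedModule cG U (m≤n*m ∣ U ∣ 4)
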